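{- There is a first-order sentence $\phi$ of the language of tournaments (first-order logic with equality and a single binary predicate symbol) such that a tournament $T$ is acyclically indecomposable if and only if $T$ satisfies $\phi$.
   Context: A tournament is a set with an irreflexive, antisymmetric, complete binary relation, interpreted as the binary predicate. Acyclic means no $3$-cycle. A subset $B$ of vertices is autonomous if for all $x,x'\in B$ and $y\notin B$, $(x,y)$ is an edge iff $(x',y)$ is an edge. A tournament is acyclically indecomposable if no autonomous subset inducing an acyclic tournament has more than one element. -}

module Defs where

open import Level using (0ℓ)
open import Data.Nat using (ℕ; suc)
open import Data.Fin using (Fin; zero; suc)
open import Data.Product using (Σ; _×_; _,_; ∃)
open import Data.Sum using (_⊎_)
open import Data.Empty using (⊥)
open import Relation.Nullary using (¬_)
open import Relation.Binary.PropositionalEquality using (_≡_; _≢_)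

record Tournament : Set₁ where
  field
    V        : Set
    _⟶_      : V → V → Set
    irrefl   : ∀ x → ¬ (x ⟶ x)
    antisym  : ∀ x y → x ⟶ y → ¬ (y ⟶ x)
    complete : ∀ x y → x ≢ y → (x ⟶ y) ⊎ (y ⟶ x)

module _ (T : Tournament) where
  open Tournament T

  Autonomous : (V → Set) → Set
  Autonomous B = ∀ x x' y → B x → B x' → ¬ B y →
                 ((x ⟶ y) → (x' ⟶ y)) × ((x' ⟶ y) → (x ⟶ y))

  Acyclic : (V → Set) → Set
  Acyclic B = ∀ x y z → B x → B y → B z → ¬ ((x ⟶ y) × (y ⟶ z) × (z ⟶ x))

  MoreThanOne : (V → Set) → Set
  MoreThanOne B = Σ V λ x → Σ V λ y → B x × B y × x ≢ y

  AcyclicallyIndecomposable : Set₁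
  AcyclicallyIndecomposable =
    (B : V → Set) → Autonomous B → Acyclic B → ¬ MoreThanOne B

-- First-order logic with equality and one binary predicate symbol R.
-- Formulas with n free variables (de Bruijn indices Fin n).

data Formula : ℕ → Set where
  R    : ∀ {n} → Fin n → Fin n → Formula n
  _≐_  : ∀ {n} → Fin n → Fin n → Formula n
  ⊥′   : ∀ {n} → Formula n
  ¬′_  : ∀ {n} → Formula n → Formula n
  _∧′_ : ∀ {n} → Formula n → Formula n → Formula n
  _∨′_ : ∀ {n} → Formula n → Formula n → Formula n
  _⇒′_ : ∀ {n} → Formula n → Formula n → Formula n
  ∀′   : ∀ {n} → Formula (suc n) → Formula n
  ∃′   : ∀ {n} → Formula (suc n) → Formula n

Sentence : Set
Sentence = Formula 0

_▸_ : ∀ {A : Set} {n} → (Fin n → A) → A → Fin (suc n) → A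
(ρ ▸ a) zero    = a
(ρ ▸ a) (suc i) = ρ i

module _ (T : Tournament) where
  open Tournament T

  Sat : ∀ {n} → (Fin n → V) → Formula n → Set
  Sat ρ (R i j)   = ρ i ⟶ ρ j
  Sat ρ (i ≐ j)   = ρ i ≡ ρ j
  Sat ρ ⊥′        = ⊥
  Sat ρ (¬′ φ)    = ¬ Sat ρ φ
  Sat ρ (φ ∧′ ψ)  = Sat ρ φ × Sat ρ ψ
  Sat ρ (φ ∨′ ψ)  = Sat ρ φ ⊎ Sat ρ ψ
  Sat ρ (φ ⇒′ ψ)  = Sat ρ φ → Sat ρ ψ
  Sat ρ (∀′ φ)    = (a : V) → Sat (ρ ▸ a) φ
  Sat ρ (∃′ φ)    = Σ V λ a → Sat (ρ ▸ a) φ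

  Models : Sentence → Set
  Models φ = Sat (λ ()) φ

-- A nontrivial autonomous acyclic set B contains an edge x ⟶ y, and then
-- also the interval I(x,y) = {x, y} ∪ {z : x ⟶ z ⟶ y}: a z with x ⟶ z ⟶ y
-- outside B would, by autonomy, receive an edge from y.  I(x,y) is acyclic
-- as a subset of B, and it is autonomous: vertices outside B see it as they
-- see B, while a vertex w ∈ B ∖ I(x,y) lies above or below all of I(x,y),
-- since otherwise it either falls into I(x,y) or closes a 3-cycle inside B.
-- So acyclic indecomposability says exactly that no interval I(x,y) with
-- x ⟶ y is autonomous and acyclic, which is first-order.
module Submission where

open import Defs
open import Level using (0ℓ; suc)
open import Axiom.ExcludedMiddle using (ExcludedMiddle)
open import Data.Product using (Σ; _×_; _,_; proj₁)
open import Data.Sum using (_⊎_; inj₁; inj₂)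
open import Data.Fin using (Fin; #_)
open import Data.Empty using (⊥-elim)
open import Function using (const)
open import Relation.Nullary using (¬_; yes; no)
open import Relation.Binary.PropositionalEquality using (_≡_; _≢_; refl; ≢-sym; subst)

∈∉⇒≢ : ∀ {A : Set} (P : A → Set) {a b} → P a → ¬ P b → a ≢ b
∈∉⇒≢ P Pa ¬Pb a≡b = ¬Pb (subst P a≡b Pa)

module _ (T : Tournament) where
  open Tournament T

  ¬⟶⇒⟶ : ∀ {x y} → x ≢ y → ¬ (y ⟶ x) → x ⟶ y
  ¬⟶⇒⟶ {x} {y} x≢y y↛x with complete x y x≢y
  ... | inj₁ x⟶y = x⟶y
  ... | inj₂ y⟶x = ⊥-elim (y↛x y⟶x)

  Interval : V → V → V → Set
  Interval x y z = (z ≡ x) ⊎ ((z ≡ y) ⊎ ((x ⟶ z) × (z ⟶ y)))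

  left∈Interval : ∀ {x y} → Interval x y x
  left∈Interval = inj₁ refl

  right∈Interval : ∀ {x y} → Interval x y y
  right∈Interval = inj₂ (inj₁ refl)

  Acyclic-⊆ : ∀ {A B : V → Set} → (∀ z → A z → B z) → Acyclic T B → Acyclic T A
  Acyclic-⊆ A⊆B acB x y z Ax Ay Az = acB x y z (A⊆B x Ax) (A⊆B y Ay) (A⊆B z Az)

  HasAutonomousAcyclicInterval : Set
  HasAutonomousAcyclicInterval =
    Σ V λ x → Σ V λ y → x ≢ y × (x ⟶ y) ×
      Autonomous T (Interval x y) × Acyclic T (Interval x y)

  indecomposable⇒¬interval :
    AcyclicallyIndecomposable T → ¬ HasAutonomousAcyclicInterval
  indecomposable⇒¬interval ind (x , y , x≢y , _ , autI , acI) =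
    ind (Interval x y) autI acI (x , y , left∈Interval , right∈Interval , x≢y)

  module AutonomousAcyclic (em : ExcludedMiddle 0ℓ) {B : V → Set}
    (autB : Autonomous T B) (acB : Acyclic T B) where

    module _ {x y} (Bx : B x) (By : B y) (x⟶y : x ⟶ y) where

      Interval-⊆ : ∀ z → Interval x y z → B z
      Interval-⊆ z (inj₁ refl) = Bx
      Interval-⊆ z (inj₂ (inj₁ refl)) = By
      Interval-⊆ z (inj₂ (inj₂ (x⟶z , z⟶y))) with em {B z}
      ... | yes Bz = Bz
      ... | no ¬Bz = ⊥-elim (antisym z y z⟶y (proj₁ (autB x y z Bx By ¬Bz) x⟶z))

      above-Interval : ∀ {w} → B w → ¬ Interval x y w → x ⟶ w →
                       ∀ a → Interval x y a → a ⟶ w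
      above-Interval {w} Bw w∉I x⟶w a a∈I =
        ¬⟶⇒⟶ (∈∉⇒≢ (Interval x y) a∈I w∉I) (w↛ a a∈I)
        where
        y⟶w : y ⟶ w
        y⟶w = ¬⟶⇒⟶ (∈∉⇒≢ (Interval x y) right∈Interval w∉I)
                    (λ w⟶y → w∉I (inj₂ (inj₂ (x⟶w , w⟶y))))

        w↛ : ∀ a → Interval x y a → ¬ (w ⟶ a)
        w↛ _ (inj₁ refl) = antisym x w x⟶w
        w↛ _ (inj₂ (inj₁ refl)) = antisym y w y⟶w
        w↛ a a∈I@(inj₂ (inj₂ (_ , a⟶y))) w⟶a =
          acB w a y Bw (Interval-⊆ a a∈I) By (w⟶a , a⟶y , y⟶w)

      below-Interval : ∀ {w} → B w → ¬ Interval x y w → w ⟶ x →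
                       ∀ a → Interval x y a → w ⟶ a
      below-Interval {w} Bw w∉I w⟶x a a∈I =
        ¬⟶⇒⟶ (≢-sym (∈∉⇒≢ (Interval x y) a∈I w∉I)) (↛w a a∈I)
        where
        w⟶y : w ⟶ y
        w⟶y = ¬⟶⇒⟶ (≢-sym (∈∉⇒≢ (Interval x y) right∈Interval w∉I))
                    (λ y⟶w → acB x y w Bx By Bw (x⟶y , y⟶w , w⟶x))

        ↛w : ∀ a → Interval x y a → ¬ (a ⟶ w)
        ↛w _ (inj₁ refl) = antisym w x w⟶x
        ↛w _ (inj₂ (inj₁ refl)) = antisym w y w⟶y
        ↛w a a∈I@(inj₂ (inj₂ (x⟶a , _))) a⟶w =
          acB a w x (Interval-⊆ a a∈I) Bw Bx (a⟶w , w⟶x , x⟶a)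

      Interval-autonomous : Autonomous T (Interval x y)
      Interval-autonomous a a′ w a∈I a′∈I w∉I with em {B w}
      ... | no ¬Bw = autB a a′ w (Interval-⊆ a a∈I) (Interval-⊆ a′ a′∈I) ¬Bw
      ... | yes Bw with complete x w (∈∉⇒≢ (Interval x y) left∈Interval w∉I)
      ...   | inj₁ x⟶w = const (above-Interval Bw w∉I x⟶w a′ a′∈I)
                        , const (above-Interval Bw w∉I x⟶w a a∈I)
      ...   | inj₂ w⟶x =
          (λ a⟶w → ⊥-elim (antisym w a (below-Interval Bw w∉I w⟶x a a∈I) a⟶w))
        , (λ a′⟶w → ⊥-elim (antisym w a′ (below-Interval Bw w∉I w⟶x a′ a′∈I) a′⟶w))

      Interval-acyclic : Acyclic T (Interval x y)
      Interval-acyclic = Acyclic-⊆ Interval-⊆ acB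

      autonomousAcyclicInterval : x ≢ y → HasAutonomousAcyclicInterval
      autonomousAcyclicInterval x≢y =
        x , y , x≢y , x⟶y , Interval-autonomous , Interval-acyclic

  ¬interval⇒indecomposable : ExcludedMiddle 0ℓ →
    ¬ HasAutonomousAcyclicInterval → AcyclicallyIndecomposable T
  ¬interval⇒indecomposable em noI B autB acB (a , b , Ba , Bb , a≢b)
    with complete a b a≢b
  ... | inj₁ a⟶b = noI (autonomousAcyclicInterval Ba Bb a⟶b a≢b)
    where open AutonomousAcyclic em autB acB
  ... | inj₂ b⟶a = noI (autonomousAcyclicInterval Bb Ba b⟶a (≢-sym a≢b))
    where open AutonomousAcyclic em autB acB

interval : ∀ {n} → Fin n → Fin n → Fin n → Formula n
interval x y z = (z ≐ x) ∨′ ((z ≐ y) ∨′ (R x z ∧′ R z y))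

-- Formulas in the two free variables x = # 1 and y = # 0; under three more
-- quantifiers these become # 4 and # 3.
autonomousInterval : Formula 2
autonomousInterval =
  ∀′ (∀′ (∀′ (I (# 2) ⇒′ (I (# 1) ⇒′ ((¬′ I (# 0)) ⇒′
    ((R (# 2) (# 0) ⇒′ R (# 1) (# 0)) ∧′ (R (# 1) (# 0) ⇒′ R (# 2) (# 0))))))))
  where I = interval (# 4) (# 3)

acyclicInterval : Formula 2
acyclicInterval =
  ∀′ (∀′ (∀′ (I (# 2) ⇒′ (I (# 1) ⇒′ (I (# 0) ⇒′
    (¬′ (R (# 2) (# 1) ∧′ (R (# 1) (# 0) ∧′ R (# 0) (# 2)))))))))
  where I = interval (# 4) (# 3)

-- Its satisfaction unfolds definitionally to ¬ HasAutonomousAcyclicInterval T.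
noAutonomousAcyclicInterval : Sentence
noAutonomousAcyclicInterval =
  ¬′ ∃′ (∃′ ((¬′ ((# 1) ≐ (# 0))) ∧′
    (R (# 1) (# 0) ∧′ (autonomousInterval ∧′ acyclicInterval))))

lemma3p13 : ExcludedMiddle 0ℓ → ExcludedMiddle (suc 0ℓ) →
    Σ Sentence λ φ → (T : Tournament) →
    (AcyclicallyIndecomposable T → Models T φ) × (Models T φ → AcyclicallyIndecomposable T)
lemma3p13 em _ = noAutonomousAcyclicInterval , λ T →
  indecomposable⇒¬interval T , ¬interval⇒indecomposable T em
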